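{- Let $\delta>-1$ and let $r\ge2$ be an integer. In the preferential attachment process $\{G_{1,\delta}(t)\}$, let $X(t)$ ($t\ge r$) be the number of descendants of $r$ among $[t]$; let $\gamma=0$ if the edge of vertex $r$ is a loop at $r$ and $\gamma=-1$ otherwise. Let $\beta=\frac{1+\delta}{2+\delta}$ and $Z(t)=X(t)+\frac{\gamma}{2+\delta}$. Then for every integer $\ell\ge1$ and $t\ge r$, conditioned on the attachment record up to time $t$ (starting with the attachment decision of vertex $r$), $$\mathbb E\left[Z(t+1)^{(\ell)}\,\middle|\,\circ\right]=\frac{t+\beta+\ell}{t+\beta}\,Z(t)^{(\ell)}.$$ Consequently $M(t):=\frac{Z(t)^{(\ell)}}{(t+\beta)^{(\ell)}}$, $t\ge r$, is a martingale.
   Context: $z^{(\ell)}=\prod_{j=0}^{\ell-1}(z+j)$ denotes the rising factorial. Preferential attachment process with $m=1$: $G_{1,\delta}(1)$ is vertex $1$ with one loop; for $t\ge1$, vertex $t+1$ is added with one edge whose other endpoint $w$ satisfies $\mathbb P(w=x)=\frac{d_t(x)+\delta}{(2+\delta)t+1+\delta}$ for $x\in[t]$ (where $d_t(x)$ is the degree of $x$ in $G_{1,\delta}(t)$, a loop counting $2$) and $\mathbb P(w=t+1)=\frac{1+\delta}{(2+\delta)t+1+\delta}$ (a loop). Descendants of $r$: $r$ is a descendant of itself; $x>r$ is a descendant of $r$ iff the edge of $x$ goes to a vertex $y<x$ that is a descendant of $r$.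
   Formalization: The parameter δ ranges over the rationals greater than −1. -}

module Defs where

open import Data.Nat as ℕ using (ℕ; zero; suc; _≤_; _<_; _≡ᵇ_; _<ᵇ_)
open import Data.Bool using (Bool; true; false; if_then_else_; _∧_)
open import Data.Integer using (+_)
open import Data.Rational using (ℚ; 0ℚ; 1ℚ; _+_; _*_; _÷_; _/_; -_; ≢-nonZero)
open import Data.Rational.Properties using (_≟_)
open import Relation.Nullary using (yes; no)
open import Relation.Binary.PropositionalEquality using (_≡_)
open import Data.Product using (_×_)

ℕ→ℚ : ℕ → ℚ
ℕ→ℚ n = + n / 1

-- total division on ℚ (x / 0 := 0); only ever used with nonzero denominators
_÷'_ : ℚ → ℚ → ℚ
p ÷' q with q ≟ 0ℚ
... | yes _ = 0ℚ
... | no q≢0 = _÷_ p q {{≢-nonZero q≢0}}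

sumFrom1 : ℕ → (ℕ → ℚ) → ℚ
sumFrom1 zero f = 0ℚ
sumFrom1 (suc n) f = sumFrom1 n f + f (suc n)

rising : ℚ → ℕ → ℚ
rising z zero = 1ℚ
rising z (suc l) = rising z l * (z + ℕ→ℚ l)

-- An attachment record: h s is the endpoint of the (unique) edge of vertex s
-- (h s = s means a loop).
ValidRecord : ℕ → (ℕ → ℕ) → Set
ValidRecord t h = (h 1 ≡ 1) × (∀ s → 1 ≤ s → s ≤ t → (1 ≤ h s) × (h s ≤ s))

extend : (ℕ → ℕ) → ℕ → ℕ → (ℕ → ℕ)
extend h t w s = if s ≡ᵇ suc t then w else h s

[_] : Bool → ℚ
[ true ] = 1ℚ
[ false ] = 0ℚ

degree : (ℕ → ℕ) → ℕ → ℕ → ℚ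
degree h t x = sumFrom1 t (λ s → [ s ≡ᵇ x ] + [ h s ≡ᵇ x ])

attachProb : ℚ → (ℕ → ℕ) → ℕ → ℕ → ℚ
attachProb δ h t w =
  (if w ≡ᵇ suc t then 1ℚ + δ else degree h t w + δ)
    ÷' ((ℕ→ℚ 2 + δ) * ℕ→ℚ t + 1ℚ + δ)

isDescF : (ℕ → ℕ) → ℕ → ℕ → ℕ → Bool
isDescF h r zero x = false
isDescF h r (suc n) x =
  if x ≡ᵇ r then true
  else if (r <ᵇ x) ∧ (h x <ᵇ x) then isDescF h r n (h x) else false

-- fuel x+1 suffices since the chain x > h x > ... strictly decreases
isDesc : (ℕ → ℕ) → ℕ → ℕ → Bool
isDesc h r x = isDescF h r (suc x) x

X : (ℕ → ℕ) → ℕ → ℕ → ℚ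
X h r t = sumFrom1 t (λ x → [ isDesc h r x ])

γ : (ℕ → ℕ) → ℕ → ℚ
γ h r = if h r ≡ᵇ r then 0ℚ else - 1ℚ

β : ℚ → ℚ
β δ = (1ℚ + δ) ÷' (ℕ→ℚ 2 + δ)

Z : ℚ → (ℕ → ℕ) → ℕ → ℕ → ℚ
Z δ h r t = X h r t + (γ h r ÷' (ℕ→ℚ 2 + δ))

condExp : ℚ → (ℕ → ℕ) → ℕ → ((ℕ → ℕ) → ℚ) → ℚ
condExp δ h t F = sumFrom1 (suc t) (λ w → attachProb δ h t w * F (extend h t w))

M : ℚ → ℕ → (ℕ → ℕ) → ℕ → ℕ → ℚ
M δ ℓ h r t = rising (Z δ h r t) ℓ ÷' rising (ℕ→ℚ t + β δ) ℓ

{-# OPTIONS --safe #-}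
module Submission where

-- Let ξ indicate that vertex t+1 attaches to a descendant of r, so Z(t+1) = Z(t) + ξ.
-- Every edge other than that of r joins two descendants or two non-descendants, so the
-- descendants carry total degree 2X(t) + γ and total attachment weight (2+δ)X(t) + γ =
-- (2+δ)Z(t), out of a normaliser (2+δ)(t+β); hence P(ξ = 1) = Z(t)/(t+β). Since
-- Z·((Z+1)^(ℓ) − Z^(ℓ)) = ℓ·Z^(ℓ), the conditional expectation of (Z+ξ)^(ℓ) is
-- Z^(ℓ)·(t+β+ℓ)/(t+β), and (t+β)·(t+1+β)^(ℓ) = (t+β)^(ℓ)·(t+β+ℓ) makes M a martingale.

open import Defs
open import Data.Nat using (ℕ; suc; _≤_)
open import Data.Rational using (ℚ; _<_; _+_; _*_; -_; 1ℚ)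
open import Data.Product using (_×_)
open import Relation.Binary.PropositionalEquality using (_≡_)

open import Data.Bool using (true; false; T; if_then_else_)
import Data.Integer as ℤ
open import Data.Nat as ℕ using (zero; z≤n; s≤s; _≡ᵇ_; _<ᵇ_)
import Data.Nat.Properties as ℕₚ
open import Data.Nat.Coprimality as Coprime using (1-coprimeTo)
import Data.Integer.Properties as ℤₚ
open import Data.Product using (_,_; proj₁; proj₂)
open import Data.Rational
  using (0ℚ; _-_; _/_; _÷_; 1/_; mkℚ; NonZero; Positive; NonNegative; positive)
open import Data.Rational.Properties
open import Data.Rational.Solver using (module +-*-Solver)
open import Data.Sum using (inj₁; inj₂)
open import Relation.Binary.Definitions using (tri<; tri≈; tri>)
open import Relation.Binary.PropositionalEquality
  using (_≢_; refl; sym; trans; cong; cong₂; subst; module ≡-Reasoning)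
open import Relation.Nullary using (¬_; yes; no)
open import Relation.Nullary.Decidable using (dec-true; dec-false)
open +-*-Solver
open ≡-Reasoning

≡ᵇ-true : ∀ {m n} → m ≡ n → (m ≡ᵇ n) ≡ true
≡ᵇ-true {m} {n} = dec-true (m ℕₚ.≟ n)

≡ᵇ-false : ∀ {m n} → m ≢ n → (m ≡ᵇ n) ≡ false
≡ᵇ-false {m} {n} = dec-false (m ℕₚ.≟ n)

<ᵇ-true : ∀ {m n} → m ℕ.< n → (m <ᵇ n) ≡ true
<ᵇ-true {m} {n} = dec-true (m ℕₚ.<? n)

<ᵇ-false : ∀ {m n} → ¬ m ℕ.< n → (m <ᵇ n) ≡ false
<ᵇ-false {m} {n} = dec-false (m ℕₚ.<? n)

ℕ→ℚ-suc : ∀ n → ℕ→ℚ (suc n) ≡ ℕ→ℚ n + 1ℚ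
ℕ→ℚ-suc n = begin
  ℤ.+ suc n / 1                                          ≡⟨ cong (_/ 1) numerator ⟩
  ((ℤ.+ n ℤ.* ℤ.+ 1) ℤ.+ (ℤ.+ 1 ℤ.* ℤ.+ 1)) / 1          ≡⟨⟩
  mkℚ (ℤ.+ n) 0 n/1-coprime + 1ℚ                         ≡⟨ cong (_+ 1ℚ) (normalize-coprime n/1-coprime) ⟨
  ℕ→ℚ n + 1ℚ                                             ∎
  where
  n/1-coprime = Coprime.sym (1-coprimeTo n)
  numerator : ℤ.+ suc n ≡ (ℤ.+ n ℤ.* ℤ.+ 1) ℤ.+ (ℤ.+ 1 ℤ.* ℤ.+ 1)
  numerator = trans (cong ℤ.+_ (ℕₚ.+-comm 1 n)) (cong (ℤ._+ ℤ.+ 1) (sym (ℤₚ.*-identityʳ (ℤ.+ n))))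

ℕ→ℚ-nonNeg : ∀ n → NonNegative (ℕ→ℚ n)
ℕ→ℚ-nonNeg n = normalize-nonNeg n 1

÷'-≡-÷ : ∀ p q .{{_ : NonZero q}} → p ÷' q ≡ p ÷ q
÷'-≡-÷ p q with q ≟ 0ℚ
÷'-≡-÷ p q {{()}} | yes refl
... | no _ = refl

÷'-*-cancel : ∀ p q .{{_ : NonZero q}} → (p ÷' q) * q ≡ p
÷'-*-cancel p q = begin
  (p ÷' q) * q     ≡⟨ cong (_* q) (÷'-≡-÷ p q) ⟩
  p * 1/ q * q     ≡⟨ *-assoc p (1/ q) q ⟩
  p * (1/ q * q)   ≡⟨ cong (p *_) (*-inverseˡ q) ⟩
  p * 1ℚ           ≡⟨ *-identityʳ p ⟩
  p                ∎

*≡⇒≡÷' : ∀ {x p} q .{{_ : NonZero q}} → x * q ≡ p → x ≡ p ÷' q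
*≡⇒≡÷' {x} {p} q xq≡p = begin
  x                 ≡⟨ *-identityʳ x ⟨
  x * 1ℚ            ≡⟨ cong (x *_) (*-inverseʳ q) ⟨
  x * (q * 1/ q)    ≡⟨ *-assoc x q (1/ q) ⟨
  x * q * 1/ q      ≡⟨ cong (_* 1/ q) xq≡p ⟩
  p * 1/ q          ≡⟨ ÷'-≡-÷ p q ⟨
  p ÷' q            ∎

÷'-inverse : ∀ q .{{_ : NonZero q}} → q ÷' q ≡ 1ℚ
÷'-inverse q = sym (*≡⇒≡÷' q (*-identityˡ q))

÷'-*-comm : ∀ p q r .{{_ : NonZero q}} → (p ÷' q) * r ≡ (p * r) ÷' q
÷'-*-comm p q r = *≡⇒≡÷' q (begin
  (p ÷' q) * r * q   ≡⟨ solve 3 (λ x r q → x :* r :* q := x :* q :* r) refl (p ÷' q) r q ⟩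
  (p ÷' q) * q * r   ≡⟨ cong (_* r) (÷'-*-cancel p q) ⟩
  p * r              ∎)

÷'-distribʳ-+ : ∀ p r q .{{_ : NonZero q}} → (p + r) ÷' q ≡ p ÷' q + r ÷' q
÷'-distribʳ-+ p r q = sym (*≡⇒≡÷' q (begin
  (p ÷' q + r ÷' q) * q       ≡⟨ *-distribʳ-+ q (p ÷' q) (r ÷' q) ⟩
  (p ÷' q) * q + (r ÷' q) * q ≡⟨ cong₂ _+_ (÷'-*-cancel p q) (÷'-*-cancel r q) ⟩
  p + r                       ∎))

*-÷'-assoc : ∀ p r q .{{_ : NonZero q}} → p * (r ÷' q) ≡ (p * r) ÷' q
*-÷'-assoc p r q = begin
  p * (r ÷' q)   ≡⟨ *-comm p (r ÷' q) ⟩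
  (r ÷' q) * p   ≡⟨ ÷'-*-comm r q p ⟩
  (r * p) ÷' q   ≡⟨ cong (_÷' q) (*-comm r p) ⟩
  (p * r) ÷' q   ∎

*-÷'-*-cancelˡ : ∀ c p q .{{_ : NonZero q}} .{{_ : NonZero (c * q)}} → (c * p) ÷' (c * q) ≡ p ÷' q
*-÷'-*-cancelˡ c p q = sym (*≡⇒≡÷' (c * q) (begin
  (p ÷' q) * (c * q)   ≡⟨ solve 3 (λ x c q → x :* (c :* q) := c :* (x :* q)) refl (p ÷' q) c q ⟩
  c * ((p ÷' q) * q)   ≡⟨ cong (c *_) (÷'-*-cancel p q) ⟩
  c * p                ∎))

sumFrom1-cong : ∀ n {f g : ℕ → ℚ} → (∀ i → 1 ≤ i → i ≤ n → f i ≡ g i) → sumFrom1 n f ≡ sumFrom1 n g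
sumFrom1-cong zero    f≗g = refl
sumFrom1-cong (suc n) f≗g =
  cong₂ _+_ (sumFrom1-cong n (λ i 1≤i i≤n → f≗g i 1≤i (ℕₚ.m≤n⇒m≤1+n i≤n))) (f≗g (suc n) (s≤s z≤n) ℕₚ.≤-refl)

sumFrom1-+ : ∀ n (f g : ℕ → ℚ) → sumFrom1 n (λ i → f i + g i) ≡ sumFrom1 n f + sumFrom1 n g
sumFrom1-+ zero    f g = refl
sumFrom1-+ (suc n) f g = begin
  sumFrom1 n (λ i → f i + g i) + (f (suc n) + g (suc n))
    ≡⟨ cong (_+ (f (suc n) + g (suc n))) (sumFrom1-+ n f g) ⟩
  sumFrom1 n f + sumFrom1 n g + (f (suc n) + g (suc n))
    ≡⟨ solve 4 (λ a b c d → (a :+ b) :+ (c :+ d) := (a :+ c) :+ (b :+ d)) refl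
         (sumFrom1 n f) (sumFrom1 n g) (f (suc n)) (g (suc n)) ⟩
  sumFrom1 n f + f (suc n) + (sumFrom1 n g + g (suc n)) ∎

sumFrom1-*ʳ : ∀ n (f : ℕ → ℚ) c → sumFrom1 n (λ i → f i * c) ≡ sumFrom1 n f * c
sumFrom1-*ʳ zero    f c = sym (*-zeroˡ c)
sumFrom1-*ʳ (suc n) f c =
  trans (cong (_+ f (suc n) * c) (sumFrom1-*ʳ n f c)) (sym (*-distribʳ-+ c (sumFrom1 n f) (f (suc n))))

sumFrom1-÷' : ∀ n (f : ℕ → ℚ) q .{{_ : NonZero q}} → sumFrom1 n (λ i → f i ÷' q) ≡ sumFrom1 n f ÷' q
sumFrom1-÷' zero    f q = *≡⇒≡÷' q (*-zeroˡ q)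
sumFrom1-÷' (suc n) f q =
  trans (cong (_+ f (suc n) ÷' q) (sumFrom1-÷' n f q)) (sym (÷'-distribʳ-+ (sumFrom1 n f) (f (suc n)) q))

sumFrom1-const : ∀ n c → sumFrom1 n (λ _ → c) ≡ ℕ→ℚ n * c
sumFrom1-const zero    c = sym (*-zeroˡ c)
sumFrom1-const (suc n) c = begin
  sumFrom1 n (λ _ → c) + c   ≡⟨ cong (_+ c) (sumFrom1-const n c) ⟩
  ℕ→ℚ n * c + c              ≡⟨ solve 2 (λ m c → m :* c :+ c := (m :+ con 1ℚ) :* c) refl (ℕ→ℚ n) c ⟩
  (ℕ→ℚ n + 1ℚ) * c           ≡⟨ cong (_* c) (ℕ→ℚ-suc n) ⟨
  ℕ→ℚ (suc n) * c            ∎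

sumFrom1-swap : ∀ m n (f : ℕ → ℕ → ℚ) →
  sumFrom1 m (λ i → sumFrom1 n (λ j → f i j)) ≡ sumFrom1 n (λ j → sumFrom1 m (λ i → f i j))
sumFrom1-swap zero    n f = sym (trans (sumFrom1-const n 0ℚ) (*-zeroʳ (ℕ→ℚ n)))
sumFrom1-swap (suc m) n f = begin
  sumFrom1 m (λ i → sumFrom1 n (f i)) + sumFrom1 n (f (suc m))
    ≡⟨ cong (_+ sumFrom1 n (f (suc m))) (sumFrom1-swap m n f) ⟩
  sumFrom1 n (λ j → sumFrom1 m (λ i → f i j)) + sumFrom1 n (f (suc m))
    ≡⟨ sumFrom1-+ n (λ j → sumFrom1 m (λ i → f i j)) (f (suc m)) ⟨
  sumFrom1 n (λ j → sumFrom1 (suc m) (λ i → f i j)) ∎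

sumFrom1-indicator-beyond : ∀ n a (g : ℕ → ℚ) → n ℕ.< a → sumFrom1 n (λ w → [ a ≡ᵇ w ] * g w) ≡ 0ℚ
sumFrom1-indicator-beyond zero    a g _   = refl
sumFrom1-indicator-beyond (suc n) a g n<a
  rewrite sumFrom1-indicator-beyond n a g (ℕₚ.<-trans (ℕₚ.n<1+n n) n<a)
        | ≡ᵇ-false (ℕₚ.>⇒≢ n<a) = cong (0ℚ +_) (*-zeroˡ (g (suc n)))

sumFrom1-indicator : ∀ n a (g : ℕ → ℚ) → 1 ≤ a → a ≤ n → sumFrom1 n (λ w → [ a ≡ᵇ w ] * g w) ≡ g a
sumFrom1-indicator zero    (suc _) g _ ()
sumFrom1-indicator (suc n) a g 1≤a a≤1+n with ℕₚ.m≤n⇒m<n∨m≡n a≤1+n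
... | inj₁ a<1+n rewrite sumFrom1-indicator n a g 1≤a (ℕₚ.≤-pred a<1+n) | ≡ᵇ-false (ℕₚ.<⇒≢ a<1+n) =
  trans (cong (g a +_) (*-zeroˡ (g (suc n)))) (+-identityʳ (g a))
... | inj₂ refl rewrite sumFrom1-indicator-beyond n (suc n) g ℕₚ.≤-refl | ≡ᵇ-true {suc n} refl =
  trans (+-identityˡ _) (*-identityˡ (g (suc n)))

handshake : ∀ t h (g : ℕ → ℚ) → (∀ s → 1 ≤ s → s ≤ t → 1 ≤ h s × h s ≤ t) →
  sumFrom1 t (λ w → degree h t w * g w) ≡ sumFrom1 t (λ s → g s + g (h s))
handshake t h g endpoints = begin
  sumFrom1 t (λ w → degree h t w * g w)
    ≡⟨ sumFrom1-cong t (λ w _ _ → sumFrom1-*ʳ t (λ s → [ s ≡ᵇ w ] + [ h s ≡ᵇ w ]) (g w)) ⟨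
  sumFrom1 t (λ w → sumFrom1 t (λ s → ([ s ≡ᵇ w ] + [ h s ≡ᵇ w ]) * g w))
    ≡⟨ sumFrom1-swap t t (λ w s → ([ s ≡ᵇ w ] + [ h s ≡ᵇ w ]) * g w) ⟩
  sumFrom1 t (λ s → sumFrom1 t (λ w → ([ s ≡ᵇ w ] + [ h s ≡ᵇ w ]) * g w))
    ≡⟨ sumFrom1-cong t edge-contribution ⟩
  sumFrom1 t (λ s → g s + g (h s)) ∎
  where
  edge-contribution : ∀ s → 1 ≤ s → s ≤ t →
    sumFrom1 t (λ w → ([ s ≡ᵇ w ] + [ h s ≡ᵇ w ]) * g w) ≡ g s + g (h s)
  edge-contribution s 1≤s s≤t = begin
    sumFrom1 t (λ w → ([ s ≡ᵇ w ] + [ h s ≡ᵇ w ]) * g w)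
      ≡⟨ sumFrom1-cong t (λ w _ _ → *-distribʳ-+ (g w) [ s ≡ᵇ w ] [ h s ≡ᵇ w ]) ⟩
    sumFrom1 t (λ w → [ s ≡ᵇ w ] * g w + [ h s ≡ᵇ w ] * g w)
      ≡⟨ sumFrom1-+ t (λ w → [ s ≡ᵇ w ] * g w) (λ w → [ h s ≡ᵇ w ] * g w) ⟩
    sumFrom1 t (λ w → [ s ≡ᵇ w ] * g w) + sumFrom1 t (λ w → [ h s ≡ᵇ w ] * g w)
      ≡⟨ cong₂ _+_ (sumFrom1-indicator t s g 1≤s s≤t)
                   (sumFrom1-indicator t (h s) g (proj₁ (endpoints s 1≤s s≤t)) (proj₂ (endpoints s 1≤s s≤t))) ⟩
    g s + g (h s) ∎

ValidRecord⇒endpoints : ∀ {t h} → ValidRecord t h → ∀ s → 1 ≤ s → s ≤ t → 1 ≤ h s × h s ≤ t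
ValidRecord⇒endpoints (_ , valid) s 1≤s s≤t =
  proj₁ (valid s 1≤s s≤t) , ℕₚ.≤-trans (proj₂ (valid s 1≤s s≤t)) s≤t

sumFrom1-attachWeight : ∀ δ t h (g : ℕ → ℚ) → ValidRecord t h →
  sumFrom1 t (λ w → (degree h t w + δ) * g w) ≡ sumFrom1 t (λ s → g s + g (h s)) + sumFrom1 t g * δ
sumFrom1-attachWeight δ t h g v = begin
  sumFrom1 t (λ w → (degree h t w + δ) * g w)
    ≡⟨ sumFrom1-cong t (λ w _ _ → *-distribʳ-+ (g w) (degree h t w) δ) ⟩
  sumFrom1 t (λ w → degree h t w * g w + δ * g w)
    ≡⟨ sumFrom1-+ t (λ w → degree h t w * g w) (λ w → δ * g w) ⟩
  sumFrom1 t (λ w → degree h t w * g w) + sumFrom1 t (λ w → δ * g w)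
    ≡⟨ cong₂ _+_ (handshake t h g (ValidRecord⇒endpoints v))
                 (trans (sumFrom1-cong t (λ w _ _ → *-comm δ (g w))) (sumFrom1-*ʳ t g δ)) ⟩
  sumFrom1 t (λ s → g s + g (h s)) + sumFrom1 t g * δ ∎

isDescF-fuel : ∀ h r {m n} x → x ℕ.< m → x ℕ.< n → isDescF h r m x ≡ isDescF h r n x
isDescF-fuel h r {suc m} {suc n} x x<1+m x<1+n with x ≡ᵇ r | r <ᵇ x
... | true  | _     = refl
... | false | false = refl
... | false | true with h x <ᵇ x in hx<ᵇx
...   | false = refl
...   | true  = isDescF-fuel h r (h x) (ℕₚ.<-≤-trans hx<x (ℕₚ.≤-pred x<1+m)) (ℕₚ.<-≤-trans hx<x (ℕₚ.≤-pred x<1+n))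
  where
  hx<x : h x ℕ.< x
  hx<x = ℕₚ.<ᵇ⇒< (h x) x (subst T (sym hx<ᵇx) _)

isDescF-local : ∀ {h h'} r n x → (∀ y → y ≤ x → h y ≡ h' y) → isDescF h r n x ≡ isDescF h' r n x
isDescF-local r zero    x h≗h' = refl
isDescF-local {h} {h'} r (suc n) x h≗h' with x ≡ᵇ r | r <ᵇ x
... | true  | _     = refl
... | false | false = refl
... | false | true with h x | h' x | h≗h' x ℕₚ.≤-refl
...   | y | .y | refl with y <ᵇ x in y<ᵇx
...     | false = refl
...     | true  = isDescF-local r n y (λ z z≤y → h≗h' z (ℕₚ.≤-trans z≤y y≤x))
  where
  y≤x : y ≤ x
  y≤x = ℕₚ.<⇒≤ (ℕₚ.<ᵇ⇒< y x (subst T (sym y<ᵇx) _))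

isDesc-< : ∀ h {r x} → x ℕ.< r → isDesc h r x ≡ false
isDesc-< h x<r rewrite ≡ᵇ-false (ℕₚ.<⇒≢ x<r) | <ᵇ-false (ℕₚ.<-asym x<r) = refl

isDesc-parent : ∀ h {r x} → r ℕ.< x → h x ℕ.< x → isDesc h r x ≡ isDesc h r (h x)
isDesc-parent h {r} {x} r<x hx<x rewrite ≡ᵇ-false (ℕₚ.>⇒≢ r<x) | <ᵇ-true r<x | <ᵇ-true hx<x =
  isDescF-fuel h r (h x) hx<x ℕₚ.≤-refl

+-[false]*-identityʳ : ∀ x y → x + [ false ] * y ≡ x
+-[false]*-identityʳ x y = trans (cong (x +_) (*-zeroˡ y)) (+-identityʳ x)

isDesc-edge : ∀ h r s → h s ≤ s → [ isDesc h r (h s) ] ≡ [ isDesc h r s ] + [ r ≡ᵇ s ] * γ h r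
isDesc-edge h r s hs≤s with ℕₚ.<-cmp s r | ℕₚ.m≤n⇒m<n∨m≡n hs≤s
... | tri< s<r _ _ | _
  rewrite ≡ᵇ-false (ℕₚ.>⇒≢ s<r) | isDesc-< h s<r | isDesc-< h (ℕₚ.≤-<-trans hs≤s s<r) =
    sym (+-[false]*-identityʳ 0ℚ (γ h r))
... | tri> _ _ r<s | inj₁ hs<s rewrite ≡ᵇ-false (ℕₚ.<⇒≢ r<s) | isDesc-parent h r<s hs<s =
  sym (+-[false]*-identityʳ [ isDesc h r (h s) ] (γ h r))
... | tri> _ _ r<s | inj₂ hs≡s rewrite ≡ᵇ-false (ℕₚ.<⇒≢ r<s) =
  trans (cong (λ x → [ isDesc h r x ]) hs≡s) (sym (+-[false]*-identityʳ [ isDesc h r s ] (γ h r)))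
... | tri≈ _ refl _ | inj₁ hs<s rewrite isDesc-< h hs<s | ≡ᵇ-true {s} refl | ≡ᵇ-false (ℕₚ.<⇒≢ hs<s) = refl
... | tri≈ _ refl _ | inj₂ hs≡s rewrite hs≡s | ≡ᵇ-true {s} refl = refl

sumFrom1-isDesc-edge : ∀ h r t → ValidRecord t h → 1 ≤ r → r ≤ t →
  sumFrom1 t (λ s → [ isDesc h r s ] + [ isDesc h r (h s) ]) ≡ X h r t + (X h r t + γ h r)
sumFrom1-isDesc-edge h r t (_ , valid) 1≤r r≤t = begin
  sumFrom1 t (λ s → desc s + desc (h s))
    ≡⟨ sumFrom1-cong t (λ s 1≤s s≤t → cong (desc s +_) (isDesc-edge h r s (proj₂ (valid s 1≤s s≤t)))) ⟩
  sumFrom1 t (λ s → desc s + (desc s + [ r ≡ᵇ s ] * γ h r))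
    ≡⟨ sumFrom1-+ t desc (λ s → desc s + [ r ≡ᵇ s ] * γ h r) ⟩
  X h r t + sumFrom1 t (λ s → desc s + [ r ≡ᵇ s ] * γ h r)
    ≡⟨ cong (X h r t +_) (sumFrom1-+ t desc (λ s → [ r ≡ᵇ s ] * γ h r)) ⟩
  X h r t + (X h r t + sumFrom1 t (λ s → [ r ≡ᵇ s ] * γ h r))
    ≡⟨ cong (λ e → X h r t + (X h r t + e)) (sumFrom1-indicator t r (λ _ → γ h r) 1≤r r≤t) ⟩
  X h r t + (X h r t + γ h r) ∎
  where
  desc : ℕ → ℚ
  desc x = [ isDesc h r x ]

extend-old : ∀ h t w {y} → y ≤ t → extend h t w y ≡ h y
extend-old h t w y≤t rewrite ≡ᵇ-false (ℕₚ.<⇒≢ (s≤s y≤t)) = refl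

extend-new : ∀ h t w → extend h t w (suc t) ≡ w
extend-new h t w rewrite ≡ᵇ-true {t} refl = refl

X-extend : ∀ h r t w → X (extend h t w) r t ≡ X h r t
X-extend h r t w = sumFrom1-cong t (λ x _ x≤t →
  cong [_] (isDescF-local r (suc x) x (λ y y≤x → extend-old h t w (ℕₚ.≤-trans y≤x x≤t))))

γ-extend : ∀ h {r t} w → r ≤ t → γ (extend h t w) r ≡ γ h r
γ-extend h w r≤t rewrite extend-old h _ w r≤t = refl

isDesc-extend : ∀ h {r t w} → r ≤ t → w ≤ t → isDesc (extend h t w) r (suc t) ≡ isDesc h r w
isDesc-extend h {r} {t} {w} r≤t w≤t = begin
  isDesc h' r (suc t)        ≡⟨ isDesc-parent h' (s≤s r≤t) (subst (ℕ._< suc t) (sym (extend-new h t w)) (s≤s w≤t)) ⟩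
  isDesc h' r (h' (suc t))   ≡⟨ cong (isDesc h' r) (extend-new h t w) ⟩
  isDesc h' r w              ≡⟨ isDescF-local r (suc w) w (λ y y≤w → extend-old h t w (ℕₚ.≤-trans y≤w w≤t)) ⟩
  isDesc h r w               ∎
  where
  h' = extend h t w

isDesc-extend-loop : ∀ h {r t} → r ≤ t → isDesc (extend h t (suc t)) r (suc t) ≡ false
isDesc-extend-loop h {r} {t} r≤t
  rewrite ≡ᵇ-false (ℕₚ.>⇒≢ (s≤s r≤t)) | <ᵇ-true (s≤s r≤t) | extend-new h t (suc t)
        | <ᵇ-false (ℕₚ.<-irrefl {suc t} refl) = refl

Z-extend : ∀ δ h {r t} w → r ≤ t →
  Z δ (extend h t w) r (suc t) ≡ Z δ h r t + [ isDesc (extend h t w) r (suc t) ]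
Z-extend δ h {r} {t} w r≤t rewrite X-extend h r t w | γ-extend h w r≤t =
  solve 3 (λ x d g → (x :+ d) :+ g := (x :+ g) :+ d) refl
    (X h r t) [ isDesc (extend h t w) r (suc t) ] (γ h r ÷' (ℕ→ℚ 2 + δ))

rising-sucˡ : ∀ z ℓ → rising z (suc ℓ) ≡ z * rising (z + 1ℚ) ℓ
rising-sucˡ z zero    = solve 1 (λ z → con 1ℚ :* (z :+ con 0ℚ) := z :* con 1ℚ) refl z
rising-sucˡ z (suc ℓ) = begin
  rising z (suc ℓ) * (z + ℕ→ℚ (suc ℓ))        ≡⟨ cong₂ (λ a b → a * (z + b)) (rising-sucˡ z ℓ) (ℕ→ℚ-suc ℓ) ⟩
  z * rising (z + 1ℚ) ℓ * (z + (ℕ→ℚ ℓ + 1ℚ))  ≡⟨ solve 3 (λ z R l → z :* R :* (z :+ (l :+ con 1ℚ)) := z :* (R :* ((z :+ con 1ℚ) :+ l)))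
                                                    refl z (rising (z + 1ℚ) ℓ) (ℕ→ℚ ℓ) ⟩
  z * rising (z + 1ℚ) (suc ℓ)                  ∎

rising-+-indicator : ∀ z ℓ b → rising (z + [ b ]) ℓ ≡ rising z ℓ + [ b ] * (rising (z + 1ℚ) ℓ - rising z ℓ)
rising-+-indicator z ℓ true  =
  solve 2 (λ R R₁ → R₁ := R :+ con 1ℚ :* (R₁ :- R)) refl (rising z ℓ) (rising (z + 1ℚ) ℓ)
rising-+-indicator z ℓ false = begin
  rising (z + 0ℚ) ℓ   ≡⟨ cong (λ x → rising x ℓ) (+-identityʳ z) ⟩
  rising z ℓ          ≡⟨ +-[false]*-identityʳ (rising z ℓ) (rising (z + 1ℚ) ℓ - rising z ℓ) ⟨
  rising z ℓ + [ false ] * (rising (z + 1ℚ) ℓ - rising z ℓ) ∎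

rising-positive : ∀ z ℓ .{{_ : Positive z}} → Positive (rising z ℓ)
rising-positive z zero    = _
rising-positive z (suc ℓ) =
  pos*pos⇒pos (rising z ℓ) {{rising-positive z ℓ}} (z + ℕ→ℚ ℓ) {{pos+nonNeg⇒pos z (ℕ→ℚ ℓ) {{ℕ→ℚ-nonNeg ℓ}}}}

rising-drift : ∀ z T ℓ .{{_ : NonZero T}} →
  rising z ℓ + (z ÷' T) * (rising (z + 1ℚ) ℓ - rising z ℓ) ≡ ((T + ℕ→ℚ ℓ) ÷' T) * rising z ℓ
rising-drift z T ℓ = begin
  R + (z ÷' T) * (R₁ - R)             ≡⟨ cong (λ q → R + q * (R₁ - R)) (÷'-≡-÷ z T) ⟩
  R + z * i * (R₁ - R)                ≡⟨ solve 4 (λ R R₁ z i → R :+ z :* i :* (R₁ :- R) := R :+ i :* (z :* R₁) :- i :* z :* R)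
                                           refl R R₁ z i ⟩
  R + i * (z * R₁) - i * z * R        ≡⟨ cong (λ x → R + i * x - i * z * R) (rising-sucˡ z ℓ) ⟨
  R + i * (R * (z + ℕ→ℚ ℓ)) - i * z * R
                                      ≡⟨ solve 4 (λ R z i l → R :+ i :* (R :* (z :+ l)) :- i :* z :* R := con 1ℚ :* R :+ l :* i :* R)
                                           refl R z i (ℕ→ℚ ℓ) ⟩
  1ℚ * R + ℕ→ℚ ℓ * i * R              ≡⟨ cong (λ x → x * R + ℕ→ℚ ℓ * i * R) (*-inverseʳ T) ⟨
  T * i * R + ℕ→ℚ ℓ * i * R           ≡⟨ solve 4 (λ T l i R → T :* i :* R :+ l :* i :* R := (T :+ l) :* i :* R) refl T (ℕ→ℚ ℓ) i R ⟩
  (T + ℕ→ℚ ℓ) * i * R                 ≡⟨ cong (_* R) (÷'-≡-÷ (T + ℕ→ℚ ℓ) T) ⟨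
  ((T + ℕ→ℚ ℓ) ÷' T) * R              ∎
  where
  R = rising z ℓ
  R₁ = rising (z + 1ℚ) ℓ
  i = 1/ T

rising-ratio : ∀ T ℓ x .{{_ : NonZero T}} .{{_ : NonZero (rising T ℓ)}} .{{_ : NonZero (rising (T + 1ℚ) ℓ)}} →
  ((T + ℕ→ℚ ℓ) ÷' T * x) ÷' rising (T + 1ℚ) ℓ ≡ x ÷' rising T ℓ
rising-ratio T ℓ x = *≡⇒≡÷' A (begin
  ((T + ℕ→ℚ ℓ) ÷' T * x) ÷' B * A      ≡⟨ cong (_* A) (÷'-≡-÷ ((T + ℕ→ℚ ℓ) ÷' T * x) B) ⟩
  (T + ℕ→ℚ ℓ) ÷' T * x * 1/ B * A      ≡⟨ cong (λ a → a * x * 1/ B * A) (÷'-≡-÷ (T + ℕ→ℚ ℓ) T) ⟩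
  (T + ℕ→ℚ ℓ) * 1/ T * x * 1/ B * A    ≡⟨ solve 6 (λ T l i x j A → (T :+ l) :* i :* x :* j :* A := x :* i :* j :* (A :* (T :+ l)))
                                            refl T (ℕ→ℚ ℓ) (1/ T) x (1/ B) A ⟩
  x * 1/ T * 1/ B * rising T (suc ℓ)   ≡⟨ cong (x * 1/ T * 1/ B *_) (rising-sucˡ T ℓ) ⟩
  x * 1/ T * 1/ B * (T * B)            ≡⟨ solve 5 (λ x i j T B → x :* i :* j :* (T :* B) := x :* (T :* i) :* (B :* j))
                                            refl x (1/ T) (1/ B) T B ⟩
  x * (T * 1/ T) * (B * 1/ B)          ≡⟨ cong₂ (λ a b → x * a * b) (*-inverseʳ T) (*-inverseʳ B) ⟩
  x * 1ℚ * 1ℚ                          ≡⟨ solve 1 (λ x → x :* con 1ℚ :* con 1ℚ := x) refl x ⟩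
  x                                    ∎)
  where
  A = rising T ℓ
  B = rising (T + 1ℚ) ℓ

condExp-cong : ∀ δ h t (F G : (ℕ → ℕ) → ℚ) → (∀ w → 1 ≤ w → w ≤ suc t → F (extend h t w) ≡ G (extend h t w)) →
  condExp δ h t F ≡ condExp δ h t G
condExp-cong δ h t F G F≗G = sumFrom1-cong (suc t) (λ w 1≤w w≤1+t → cong (attachProb δ h t w *_) (F≗G w 1≤w w≤1+t))

condExp-+ : ∀ δ h t (F G : (ℕ → ℕ) → ℚ) → condExp δ h t (λ h' → F h' + G h') ≡ condExp δ h t F + condExp δ h t G
condExp-+ δ h t F G = trans
  (sumFrom1-cong (suc t) (λ w _ _ → *-distribˡ-+ (attachProb δ h t w) (F (extend h t w)) (G (extend h t w))))
  (sumFrom1-+ (suc t) (λ w → attachProb δ h t w * F (extend h t w)) (λ w → attachProb δ h t w * G (extend h t w)))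

condExp-*ʳ : ∀ δ h t (F : (ℕ → ℕ) → ℚ) c → condExp δ h t (λ h' → F h' * c) ≡ condExp δ h t F * c
condExp-*ʳ δ h t F c = trans
  (sumFrom1-cong (suc t) (λ w _ _ → sym (*-assoc (attachProb δ h t w) (F (extend h t w)) c)))
  (sumFrom1-*ʳ (suc t) (λ w → attachProb δ h t w * F (extend h t w)) c)

condExp-÷' : ∀ δ h t (F : (ℕ → ℕ) → ℚ) q .{{_ : NonZero q}} →
  condExp δ h t (λ h' → F h' ÷' q) ≡ condExp δ h t F ÷' q
condExp-÷' δ h t F q = trans
  (sumFrom1-cong (suc t) (λ w _ _ → *-÷'-assoc (attachProb δ h t w) (F (extend h t w)) q))
  (sumFrom1-÷' (suc t) (λ w → attachProb δ h t w * F (extend h t w)) q)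

-- NonZero proofs are passed explicitly below: instance search would try to normalise
-- these open rational expressions, which is prohibitively slow.
module PreferentialAttachment (δ : ℚ) (δ>-1 : - 1ℚ < δ) (t : ℕ) where

  t+β : ℚ
  t+β = ℕ→ℚ t + β δ

  1+δ-positive : Positive (1ℚ + δ)
  1+δ-positive = positive (+-monoʳ-< 1ℚ δ>-1)

  2+δ-positive : Positive (ℕ→ℚ 2 + δ)
  2+δ-positive = subst Positive (sym (+-assoc 1ℚ 1ℚ δ)) (pos+pos⇒pos 1ℚ (1ℚ + δ) {{1+δ-positive}})

  2+δ-nonZero : NonZero (ℕ→ℚ 2 + δ)
  2+δ-nonZero = pos⇒nonZero (ℕ→ℚ 2 + δ) {{2+δ-positive}}

  β-positive : Positive (β δ)
  β-positive = subst Positive (sym (÷'-≡-÷ (1ℚ + δ) (ℕ→ℚ 2 + δ) {{2+δ-nonZero}}))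
    (pos*pos⇒pos (1ℚ + δ) {{1+δ-positive}} ((1/ (ℕ→ℚ 2 + δ)) {{2+δ-nonZero}}) {{1/pos⇒pos (ℕ→ℚ 2 + δ) {{2+δ-positive}}}})

  t+β-positive : Positive t+β
  t+β-positive = nonNeg+pos⇒pos (ℕ→ℚ t) {{ℕ→ℚ-nonNeg t}} (β δ) {{β-positive}}

  t+β-nonZero : NonZero t+β
  t+β-nonZero = pos⇒nonZero t+β {{t+β-positive}}

  denominator-nonZero : NonZero ((ℕ→ℚ 2 + δ) * t+β)
  denominator-nonZero = pos⇒nonZero ((ℕ→ℚ 2 + δ) * t+β) {{pos*pos⇒pos (ℕ→ℚ 2 + δ) {{2+δ-positive}} t+β {{t+β-positive}}}}

  rising-t+β-nonZero : ∀ ℓ → NonZero (rising t+β ℓ)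
  rising-t+β-nonZero ℓ = pos⇒nonZero (rising t+β ℓ) {{rising-positive t+β ℓ {{t+β-positive}}}}

  rising-t+β+1-nonZero : ∀ ℓ → NonZero (rising (t+β + 1ℚ) ℓ)
  rising-t+β+1-nonZero ℓ =
    pos⇒nonZero (rising (t+β + 1ℚ) ℓ) {{rising-positive (t+β + 1ℚ) ℓ {{pos+pos⇒pos t+β {{t+β-positive}} 1ℚ}}}}

  denominator-≡ : (ℕ→ℚ 2 + δ) * ℕ→ℚ t + 1ℚ + δ ≡ (ℕ→ℚ 2 + δ) * t+β
  denominator-≡ = sym (begin
    c * (ℕ→ℚ t + β δ)                ≡⟨ *-distribˡ-+ c (ℕ→ℚ t) (β δ) ⟩
    c * ℕ→ℚ t + c * β δ              ≡⟨ cong (c * ℕ→ℚ t +_) (trans (*-comm c (β δ)) (÷'-*-cancel (1ℚ + δ) c {{2+δ-nonZero}})) ⟩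
    c * ℕ→ℚ t + (1ℚ + δ)             ≡⟨ +-assoc (c * ℕ→ℚ t) 1ℚ δ ⟨
    c * ℕ→ℚ t + 1ℚ + δ               ∎)
    where
    c = ℕ→ℚ 2 + δ

  attachProb-old : ∀ h {w} → w ≤ t → attachProb δ h t w ≡ (degree h t w + δ) ÷' ((ℕ→ℚ 2 + δ) * t+β)
  attachProb-old h {w} w≤t = begin
    attachProb δ h t w
      ≡⟨ cong (λ b → (if b then 1ℚ + δ else degree h t w + δ) ÷' ((ℕ→ℚ 2 + δ) * ℕ→ℚ t + 1ℚ + δ))
              (≡ᵇ-false (ℕₚ.<⇒≢ (s≤s w≤t))) ⟩
    (degree h t w + δ) ÷' ((ℕ→ℚ 2 + δ) * ℕ→ℚ t + 1ℚ + δ)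
      ≡⟨ cong ((degree h t w + δ) ÷'_) denominator-≡ ⟩
    (degree h t w + δ) ÷' ((ℕ→ℚ 2 + δ) * t+β) ∎

  attachProb-new : ∀ h → attachProb δ h t (suc t) ≡ (1ℚ + δ) ÷' ((ℕ→ℚ 2 + δ) * t+β)
  attachProb-new h = begin
    attachProb δ h t (suc t)
      ≡⟨ cong (λ b → (if b then 1ℚ + δ else degree h t (suc t) + δ) ÷' ((ℕ→ℚ 2 + δ) * ℕ→ℚ t + 1ℚ + δ))
              (≡ᵇ-true {t} refl) ⟩
    (1ℚ + δ) ÷' ((ℕ→ℚ 2 + δ) * ℕ→ℚ t + 1ℚ + δ)
      ≡⟨ cong ((1ℚ + δ) ÷'_) denominator-≡ ⟩
    (1ℚ + δ) ÷' ((ℕ→ℚ 2 + δ) * t+β) ∎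

  condExp-weights : ∀ h (F : (ℕ → ℕ) → ℚ) → condExp δ h t F ≡
    (sumFrom1 t (λ w → (degree h t w + δ) * F (extend h t w)) + (1ℚ + δ) * F (extend h t (suc t)))
      ÷' ((ℕ→ℚ 2 + δ) * t+β)
  condExp-weights h F = begin
    sumFrom1 t (λ w → attachProb δ h t w * F (extend h t w)) + attachProb δ h t (suc t) * F new
      ≡⟨ cong₂ _+_ (sumFrom1-cong t (λ w _ w≤t → trans (cong (_* F (extend h t w)) (attachProb-old h w≤t))
                                                          (÷'-*-comm (degree h t w + δ) D (F (extend h t w)) {{denominator-nonZero}})))
                   (trans (cong (_* F new) (attachProb-new h)) (÷'-*-comm (1ℚ + δ) D (F new) {{denominator-nonZero}})) ⟩
    sumFrom1 t (λ w → ((degree h t w + δ) * F (extend h t w)) ÷' D) + ((1ℚ + δ) * F new) ÷' D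
      ≡⟨ cong (_+ ((1ℚ + δ) * F new) ÷' D) (sumFrom1-÷' t (λ w → (degree h t w + δ) * F (extend h t w)) D {{denominator-nonZero}}) ⟩
    sumFrom1 t (λ w → (degree h t w + δ) * F (extend h t w)) ÷' D + ((1ℚ + δ) * F new) ÷' D
      ≡⟨ ÷'-distribʳ-+ (sumFrom1 t (λ w → (degree h t w + δ) * F (extend h t w))) ((1ℚ + δ) * F new) D {{denominator-nonZero}} ⟨
    (sumFrom1 t (λ w → (degree h t w + δ) * F (extend h t w)) + (1ℚ + δ) * F new) ÷' D ∎
    where
    D = (ℕ→ℚ 2 + δ) * t+β
    new = extend h t (suc t)

  condExp-const-1 : ∀ h → ValidRecord t h → condExp δ h t (λ _ → 1ℚ) ≡ 1ℚ
  condExp-const-1 h v = begin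
    condExp δ h t (λ _ → 1ℚ)
      ≡⟨ condExp-weights h (λ _ → 1ℚ) ⟩
    (sumFrom1 t (λ w → (degree h t w + δ) * 1ℚ) + (1ℚ + δ) * 1ℚ) ÷' D
      ≡⟨ cong (λ x → (x + (1ℚ + δ) * 1ℚ) ÷' D) (sumFrom1-attachWeight δ t h (λ _ → 1ℚ) v) ⟩
    (sumFrom1 t (λ _ → 1ℚ + 1ℚ) + sumFrom1 t (λ _ → 1ℚ) * δ + (1ℚ + δ) * 1ℚ) ÷' D
      ≡⟨ cong₂ (λ x y → (x + y * δ + (1ℚ + δ) * 1ℚ) ÷' D) (sumFrom1-const t (1ℚ + 1ℚ)) (sumFrom1-const t 1ℚ) ⟩
    (ℕ→ℚ t * (1ℚ + 1ℚ) + ℕ→ℚ t * 1ℚ * δ + (1ℚ + δ) * 1ℚ) ÷' D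
      ≡⟨ cong (_÷' D) (solve 2 (λ n d → n :* (con 1ℚ :+ con 1ℚ) :+ n :* con 1ℚ :* d :+ (con 1ℚ :+ d) :* con 1ℚ
                                      := (con (ℕ→ℚ 2) :+ d) :* n :+ con 1ℚ :+ d) refl (ℕ→ℚ t) δ) ⟩
    ((ℕ→ℚ 2 + δ) * ℕ→ℚ t + 1ℚ + δ) ÷' D
      ≡⟨ cong (_÷' D) denominator-≡ ⟩
    D ÷' D
      ≡⟨ ÷'-inverse D {{denominator-nonZero}} ⟩
    1ℚ ∎
    where
    D = (ℕ→ℚ 2 + δ) * t+β

  condExp-isDesc : ∀ h {r} → ValidRecord t h → 1 ≤ r → r ≤ t →
    condExp δ h t (λ h' → [ isDesc h' r (suc t) ]) ≡ Z δ h r t ÷' t+β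
  condExp-isDesc h {r} v 1≤r r≤t = begin
    condExp δ h t (λ h' → [ isDesc h' r (suc t) ])
      ≡⟨ condExp-weights h (λ h' → [ isDesc h' r (suc t) ]) ⟩
    (sumFrom1 t (λ w → (degree h t w + δ) * [ isDesc (extend h t w) r (suc t) ])
      + (1ℚ + δ) * [ isDesc (extend h t (suc t)) r (suc t) ]) ÷' (c * t+β)
      ≡⟨ cong₂ (λ x b → (x + (1ℚ + δ) * [ b ]) ÷' (c * t+β))
           (sumFrom1-cong t (λ w _ w≤t → cong (λ b → (degree h t w + δ) * [ b ]) (isDesc-extend h r≤t w≤t)))
           (isDesc-extend-loop h r≤t) ⟩
    (sumFrom1 t (λ w → (degree h t w + δ) * desc w) + (1ℚ + δ) * 0ℚ) ÷' (c * t+β)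
      ≡⟨ cong (λ x → (x + (1ℚ + δ) * 0ℚ) ÷' (c * t+β))
           (trans (sumFrom1-attachWeight δ t h desc v) (cong (_+ X h r t * δ) (sumFrom1-isDesc-edge h r t v 1≤r r≤t))) ⟩
    (X h r t + (X h r t + γ h r) + X h r t * δ + (1ℚ + δ) * 0ℚ) ÷' (c * t+β)
      ≡⟨ cong (_÷' (c * t+β)) descendant-weight ⟩
    (c * Z δ h r t) ÷' (c * t+β)
      ≡⟨ *-÷'-*-cancelˡ c (Z δ h r t) t+β {{t+β-nonZero}} {{denominator-nonZero}} ⟩
    Z δ h r t ÷' t+β ∎
    where
    c = ℕ→ℚ 2 + δ
    desc : ℕ → ℚ
    desc x = [ isDesc h r x ]
    descendant-weight : X h r t + (X h r t + γ h r) + X h r t * δ + (1ℚ + δ) * 0ℚ ≡ c * Z δ h r t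
    descendant-weight = begin
      X h r t + (X h r t + γ h r) + X h r t * δ + (1ℚ + δ) * 0ℚ
        ≡⟨ solve 3 (λ x g d → x :+ (x :+ g) :+ x :* d :+ (con 1ℚ :+ d) :* con 0ℚ := (con (ℕ→ℚ 2) :+ d) :* x :+ g)
             refl (X h r t) (γ h r) δ ⟩
      c * X h r t + γ h r
        ≡⟨ cong (c * X h r t +_) (÷'-*-cancel (γ h r) c {{2+δ-nonZero}}) ⟨
      c * X h r t + (γ h r ÷' c) * c
        ≡⟨ solve 3 (λ c x q → c :* x :+ q :* c := c :* (x :+ q)) refl c (X h r t) (γ h r ÷' c) ⟩
      c * Z δ h r t ∎

  condExp-affine : ∀ h → ValidRecord t h → ∀ a (F : (ℕ → ℕ) → ℚ) b →
    condExp δ h t (λ h' → a + F h' * b) ≡ a + condExp δ h t F * b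
  condExp-affine h v a F b = begin
    condExp δ h t (λ h' → a + F h' * b)
      ≡⟨ condExp-+ δ h t (λ _ → a) (λ h' → F h' * b) ⟩
    condExp δ h t (λ _ → a) + condExp δ h t (λ h' → F h' * b)
      ≡⟨ cong₂ _+_ (condExp-cong δ h t (λ _ → a) (λ _ → 1ℚ * a) (λ _ _ _ → sym (*-identityˡ a))) (condExp-*ʳ δ h t F b) ⟩
    condExp δ h t (λ _ → 1ℚ * a) + condExp δ h t F * b
      ≡⟨ cong (_+ condExp δ h t F * b) (condExp-*ʳ δ h t (λ _ → 1ℚ) a) ⟩
    condExp δ h t (λ _ → 1ℚ) * a + condExp δ h t F * b
      ≡⟨ cong (λ p → p * a + condExp δ h t F * b) (condExp-const-1 h v) ⟩
    1ℚ * a + condExp δ h t F * b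
      ≡⟨ cong (_+ condExp δ h t F * b) (*-identityˡ a) ⟩
    a + condExp δ h t F * b ∎

  condExp-rising : ∀ h {r} → ValidRecord t h → 1 ≤ r → r ≤ t → ∀ ℓ →
    condExp δ h t (λ h' → rising (Z δ h' r (suc t)) ℓ) ≡ ((t+β + ℕ→ℚ ℓ) ÷' t+β) * rising (Z δ h r t) ℓ
  condExp-rising h {r} v 1≤r r≤t ℓ = begin
    condExp δ h t (λ h' → rising (Z δ h' r (suc t)) ℓ)
      ≡⟨ condExp-cong δ h t (λ h' → rising (Z δ h' r (suc t)) ℓ) (λ h' → rising (Z δ h r t) ℓ + [ isDesc h' r (suc t) ] * Δ)
           (λ w _ _ → trans (cong (λ z → rising z ℓ) (Z-extend δ h w r≤t))
                            (rising-+-indicator (Z δ h r t) ℓ (isDesc (extend h t w) r (suc t)))) ⟩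
    condExp δ h t (λ h' → rising (Z δ h r t) ℓ + [ isDesc h' r (suc t) ] * Δ)
      ≡⟨ condExp-affine h v (rising (Z δ h r t) ℓ) (λ h' → [ isDesc h' r (suc t) ]) Δ ⟩
    rising (Z δ h r t) ℓ + condExp δ h t (λ h' → [ isDesc h' r (suc t) ]) * Δ
      ≡⟨ cong (λ p → rising (Z δ h r t) ℓ + p * Δ) (condExp-isDesc h v 1≤r r≤t) ⟩
    rising (Z δ h r t) ℓ + (Z δ h r t ÷' t+β) * Δ
      ≡⟨ rising-drift (Z δ h r t) t+β ℓ {{t+β-nonZero}} ⟩
    ((t+β + ℕ→ℚ ℓ) ÷' t+β) * rising (Z δ h r t) ℓ ∎
    where
    Δ = rising (Z δ h r t + 1ℚ) ℓ - rising (Z δ h r t) ℓ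

  t+β-suc : ℕ→ℚ (suc t) + β δ ≡ t+β + 1ℚ
  t+β-suc = trans (cong (_+ β δ) (ℕ→ℚ-suc t)) (solve 2 (λ n b → n :+ con 1ℚ :+ b := n :+ b :+ con 1ℚ) refl (ℕ→ℚ t) (β δ))

  condExp-M : ∀ h {r} → ValidRecord t h → 1 ≤ r → r ≤ t → ∀ ℓ →
    condExp δ h t (λ h' → M δ ℓ h' r (suc t)) ≡ M δ ℓ h r t
  condExp-M h {r} v 1≤r r≤t ℓ = begin
    condExp δ h t (λ h' → M δ ℓ h' r (suc t))
      ≡⟨ condExp-cong δ h t (λ h' → M δ ℓ h' r (suc t)) (λ h' → rising (Z δ h' r (suc t)) ℓ ÷' rising (t+β + 1ℚ) ℓ)
           (λ w _ _ → cong (λ q → rising (Z δ (extend h t w) r (suc t)) ℓ ÷' rising q ℓ) t+β-suc) ⟩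
    condExp δ h t (λ h' → rising (Z δ h' r (suc t)) ℓ ÷' rising (t+β + 1ℚ) ℓ)
      ≡⟨ condExp-÷' δ h t (λ h' → rising (Z δ h' r (suc t)) ℓ) (rising (t+β + 1ℚ) ℓ) {{rising-t+β+1-nonZero ℓ}} ⟩
    condExp δ h t (λ h' → rising (Z δ h' r (suc t)) ℓ) ÷' rising (t+β + 1ℚ) ℓ
      ≡⟨ cong (_÷' rising (t+β + 1ℚ) ℓ) (condExp-rising h v 1≤r r≤t ℓ) ⟩
    ((t+β + ℕ→ℚ ℓ) ÷' t+β * rising (Z δ h r t) ℓ) ÷' rising (t+β + 1ℚ) ℓ
      ≡⟨ rising-ratio t+β ℓ (rising (Z δ h r t) ℓ) {{t+β-nonZero}} {{rising-t+β-nonZero ℓ}} {{rising-t+β+1-nonZero ℓ}} ⟩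
    M δ ℓ h r t ∎

-- The identity also holds for ℓ = 0.
lemma3p1 : (δ : ℚ) → - 1ℚ < δ → (r : ℕ) → 2 ≤ r → (ℓ : ℕ) → 1 ≤ ℓ →
    (t : ℕ) → r ≤ t → (h : ℕ → ℕ) → ValidRecord t h →
    (condExp δ h t (λ h' → rising (Z δ h' r (suc t)) ℓ)
       ≡ ((ℕ→ℚ t + β δ + ℕ→ℚ ℓ) ÷' (ℕ→ℚ t + β δ)) * rising (Z δ h r t) ℓ)
    × (condExp δ h t (λ h' → M δ ℓ h' r (suc t)) ≡ M δ ℓ h r t)
lemma3p1 δ δ>-1 r 2≤r ℓ _ t r≤t h v = condExp-rising h v 1≤r r≤t ℓ , condExp-M h v 1≤r r≤t ℓ
  where
  open PreferentialAttachment δ δ>-1 t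
  1≤r : 1 ≤ r
  1≤r = ℕₚ.<⇒≤ 2≤r
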